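{- Let $G=(V,E\cup D,z)$ be a signed graph, let $\mathcal{T}$ be a threshold network on $G$ with interaction matrix $W(G)$ and threshold vector $b\in\mathbb{Z}^V$, and let $\mu=(I_1,\ldots,I_\ell)$ be a periodic update mode, $I_k\subseteq V$. If for every $1\le k\le\ell$ every subgraph $G'$ (with at least one vertex) of the subgraph $G(I_k)$ induced by $I_k$ satisfies $\mathcal{S}(G')<0$, then every attractor of the dynamics $x\mapsto F_\mu(x)$ is a fixed point.
   Context: A signed graph $G=(V,E\cup D,z)$ consists of a finite vertex set $V$, a set $E$ of undirected edges between distinct vertices (no multiple edges), a set $D$ of self-loops (at most one per vertex), and a sign map $z:E\cup D\to\{ -1,+1\}$. For a signed graph $H$ write $n=|V(H)|$, $m=|E(H)|$, and $d^{+}$ (resp. $d^{ - }$) for its number of positive (resp. negative) self-loops. The interaction matrix $W(G)=(w_{ij})$ is symmetric with $w_{ij}=z(\{i,j\})$ if $\{i,j\}\in E$, $w_{ii}$ the sign of the loop at $i$ if present, $0$ otherwise. The sign of a cycle of the loopless part is the product of its edge signs; $H$ is antibalanced if every even cycle of its loopless part is positive and every odd cycle is negative; $\rho(H)$ is the minimum number of non-loop edges whose removal makes $H$ antibalanced; $\mathcal{S}(H)=-n-d^{+}+d^{ - }+2m-4\rho(H)$. Local functions: $f_i(x)=1$ if $\sum_{j\in V}w_{ij}x_j-b_i>0$, $f_i(x)=x_i$ if it is $0$, $f_i(x)=-1$ otherwise, for $x\in\{ -1,1\}^V$. For $I\subseteq V$, $f_I(x)_i=f_i(x)$ if $i\in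 I$ and $f_I(x)_i=x_i$ otherwise. For $\mu=(I_1,\ldots,I_\ell)$ (subsets of $V$, repetitions allowed), $F_\mu=f_{I_\ell}\circ\cdots\circ f_{I_1}$. An attractor of period $p$ is a configuration $x$ with $F_\mu^p(x)=x$, $p\ge1$ minimal; a fixed point is one of period $1$. -}

module Defs where

open import Data.Nat as ℕ using (ℕ; zero; suc; _∸_)
open import Data.Integer as ℤ using (ℤ; 0ℤ; 1ℤ; -1ℤ; +_; _<_; _*_; _-_)
open import Data.Integer.Properties using () renaming (_≟_ to _≟ℤ_)
open import Data.Fin using (Fin) renaming (_<?_ to _<ᶠ?_)
open import Data.Fin.Subset using (Subset; _∈_; _⊆_; Nonempty; ∣_∣)
open import Data.Vec using (Vec; lookup; tabulate)
open import Data.List using (List; []; _∷_; _++_; length; filter; map; foldr)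
open import Data.List.Base using (allFin)
open import Data.List.Relation.Unary.All using (All)
open import Data.List.Relation.Unary.Unique.Propositional using (Unique)
open import Data.Product using (_×_; _,_; Σ; ∃)
open import Data.Sum using (_⊎_)
open import Data.Sign using (Sign) renaming (+ to plus; - to minus)
open import Data.Bool using (Bool; if_then_else_)
open import Relation.Nullary using (¬_; does)
open import Relation.Nullary.Decidable using (_×-dec_; ¬?)
open import Relation.Binary.PropositionalEquality using (_≡_; _≢_)

-- Signed graphs on the vertex set V = Fin n, given by their interaction
-- matrix W(G): w i j ∈ {-1,0,1}, symmetric.  Off-diagonal nonzero
-- entries are the edges (with their sign), diagonal nonzero entries are
-- the self-loops (with their sign).

IsSign0 : ℤ → Set
IsSign0 x = x ≡ 0ℤ ⊎ x ≡ 1ℤ ⊎ x ≡ -1ℤ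

Matrix : ℕ → Set
Matrix n = Fin n → Fin n → ℤ

Symmetric : ∀ {n} → Matrix n → Set
Symmetric {n} a = ∀ (i j : Fin n) → a i j ≡ a j i

record SignedGraph (n : ℕ) : Set where
  field
    w     : Matrix n
    w-sym : Symmetric w
    w-val : ∀ i j → IsSign0 (w i j)
open SignedGraph public

sumℕ : List ℕ → ℕ
sumℕ = foldr ℕ._+_ 0

sumℤ : List ℤ → ℤ
sumℤ = foldr ℤ._+_ 0ℤ

prodℤ : List ℤ → ℤ
prodℤ = foldr ℤ._*_ 1ℤ

edgeCount : ∀ {n} → Matrix n → ℕ
edgeCount {n} a =
  sumℕ (map (λ i → length (filter (λ j → (i <ᶠ? j) ×-dec ¬? (a i j ≟ℤ 0ℤ)) (allFin n)))
            (allFin n))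

posLoops : ∀ {n} → Matrix n → ℕ
posLoops {n} a = length (filter (λ i → a i i ≟ℤ 1ℤ) (allFin n))

negLoops : ∀ {n} → Matrix n → ℕ
negLoops {n} a = length (filter (λ i → a i i ≟ℤ -1ℤ) (allFin n))

consecPairs : ∀ {n} → List (Fin n) → List (Fin n × Fin n)
consecPairs []            = []
consecPairs (x ∷ [])      = []
consecPairs (x ∷ y ∷ r)   = (x , y) ∷ consecPairs (y ∷ r)

cyclePairs : ∀ {n} → List (Fin n) → List (Fin n × Fin n)
cyclePairs []      = []
cyclePairs (x ∷ r) = consecPairs (x ∷ r ++ x ∷ [])

IsCycle : ∀ {n} → Matrix n → List (Fin n) → Set
IsCycle a vs =
  3 ℕ.≤ length vs × Unique vs × All (λ { (i , j) → a i j ≢ 0ℤ }) (cyclePairs vs)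

cycleSign : ∀ {n} → Matrix n → List (Fin n) → ℤ
cycleSign a vs = prodℤ (map (λ { (i , j) → a i j }) (cyclePairs vs))

negOnePow : ℕ → ℤ
negOnePow zero    = 1ℤ
negOnePow (suc k) = -1ℤ * negOnePow k

Antibalanced : ∀ {n} → Matrix n → Set
Antibalanced a = ∀ vs → IsCycle a vs → cycleSign a vs ≡ negOnePow (length vs)

EdgeRemoval : ∀ {n} → Matrix n → Matrix n → Set
EdgeRemoval {n} a a' =
  Symmetric a' × (∀ i → a' i i ≡ a i i) × (∀ i j → i ≢ j → a' i j ≡ 0ℤ ⊎ a' i j ≡ a i j)

IsRho : ∀ {n} → Matrix n → ℕ → Set
IsRho {n} a r =
  (Σ (Matrix n) λ a' → EdgeRemoval a a' × Antibalanced a' × r ≡ edgeCount a ∸ edgeCount a')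
  × (∀ (a' : Matrix n) → EdgeRemoval a a' → Antibalanced a' → r ℕ.≤ edgeCount a ∸ edgeCount a')

record Subgraph {n : ℕ} (G : SignedGraph n) (I : Subset n) : Set where
  field
    U        : Subset n
    U⊆I      : U ⊆ I
    U≠∅      : Nonempty U
    w'       : Matrix n
    w'-sym   : Symmetric w'
    w'-sub   : ∀ i j → w' i j ≡ 0ℤ ⊎ (i ∈ U × j ∈ U × w' i j ≡ w G i j)
open Subgraph public

-- 𝒮(H) = -n - d⁺ + d⁻ + 2m - 4ρ(H), given r = ρ(H)
𝒮 : ∀ {n} {G : SignedGraph n} {I : Subset n} → Subgraph G I → ℕ → ℤ
𝒮 H r = ℤ.- (+ ∣ U H ∣) - + posLoops (w' H) ℤ.+ + negLoops (w' H)
        ℤ.+ + (2 ℕ.* edgeCount (w' H)) - + (4 ℕ.* r)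

Config : ℕ → Set
Config n = Vec Sign n

spin : Sign → ℤ
spin plus  = 1ℤ
spin minus = -1ℤ

localField : ∀ {n} → SignedGraph n → (Fin n → ℤ) → Fin n → Config n → ℤ
localField {n} G b i x = sumℤ (map (λ j → w G i j * spin (lookup x j)) (allFin n)) - b i

localF : ∀ {n} → SignedGraph n → (Fin n → ℤ) → Fin n → Config n → Sign
localF G b i x with does (0ℤ ℤ.<? localField G b i x) | does (localField G b i x ≟ℤ 0ℤ)
... | Bool.true  | _          = plus
... | Bool.false | Bool.true  = lookup x i
... | Bool.false | Bool.false = minus

fI : ∀ {n} → SignedGraph n → (Fin n → ℤ) → Subset n → Config n → Config n
fI G b I x = tabulate λ i → if lookup I i then localF G b i x else lookup x i

Fμ : ∀ {n} → SignedGraph n → (Fin n → ℤ) → List (Subset n) → Config n → Config n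
Fμ G b []      x = x
Fμ G b (I ∷ μ) x = Fμ G b μ (fI G b I x)

iter : ∀ {A : Set} → (A → A) → ℕ → A → A
iter f zero    x = x
iter f (suc k) x = f (iter f k x)

IsAttractorOfPeriod : ∀ {A : Set} → (A → A) → A → ℕ → Set
IsAttractorOfPeriod F x p =
  1 ℕ.≤ p × iter F p x ≡ x × (∀ q → 1 ℕ.≤ q → q ℕ.< p → iter F q x ≢ x)

module Submission where

-- A subgraph consisting of one edge, or of one negative loop, is acyclic (ρ = 0) and has
-- 𝒮 = 0.  So the hypothesis forces every block I_k to be an independent set carrying no
-- negative loop.  For such a block the change of the Hopfield energy
-- E(x) = 2 bᵀx − xᵀWx under f_{I_k} splits into one term per vertex,
-- d_i (2 h_i + w_ii d_i) with d_i the change of x_i and h_i its threshold field, and each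
-- term is non-negative and vanishes only if x_i does not move.  Thus E strictly decreases
-- under F_μ unless x is fixed; along a cycle it cannot decrease, so F_μ x = x and p = 1.

open import Defs
open import Data.Nat using (ℕ)
open import Data.Integer using (ℤ; 0ℤ; _<_)
open import Data.Fin using (Fin)
open import Data.Fin.Subset using (Subset)
open import Data.List using (List)
open import Data.List.Membership.Propositional using (_∈_)
open import Relation.Binary.PropositionalEquality using (_≡_)

open import Data.Nat as ℕ using (zero; suc; z≤n; s≤s)
import Data.Nat.Properties as ℕP
open import Data.Integer as ℤ using (1ℤ; -1ℤ; +_; +0; +[1+_]; -[1+_]; _+_; _*_; _-_; -_; _≤_; +≤+; +<+)
import Data.Integer.Properties as ℤP
open import Data.Integer.Tactic.RingSolver using (solve-∀)
open import Data.Fin as F using (zero; suc)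
import Data.Fin.Properties as FP
open import Data.Fin.Subset using (⁅_⁆; _∪_; ∣_∣; _⊆_) renaming (_∈_ to _∈ₛ_)
open import Data.Fin.Subset.Properties using (x∈⁅x⁆; x∈⁅y⁆⇒x≡y; x∈p∪q⁺; x∈p∪q⁻; ∣⁅x⁆∣≡1; ∪-idem)
open import Data.Vec using (lookup; []; _∷_)
open import Data.Vec.Properties using (lookup∘tabulate; tabulate∘lookup; tabulate-cong; lookup⇒[]=)
open import Data.List as L using (allFin; length)
open import Data.List.Properties using (map-tabulate; filter-some; filter-none)
open import Data.List.Relation.Unary.Any using (here; there)
open import Data.List.Membership.Propositional.Properties using (∈-allFin)
open import Data.List.Relation.Unary.Any.Properties using () renaming (tabulate⁺ to Any-tabulate⁺)
open import Data.List.Relation.Unary.All using (_∷_)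
open import Data.List.Relation.Unary.All.Properties using () renaming (tabulate⁺ to All-tabulate⁺)
open import Data.List.Relation.Unary.AllPairs using (_∷_)
open import Data.Sign using (Sign) renaming (+ to plus; - to minus)
open import Data.Bool using (true; false; if_then_else_)
open import Data.Product using (_×_; _,_; proj₁; proj₂)
open import Data.Sum as Sum using (_⊎_; inj₁; inj₂)
open import Data.Empty using (⊥)
open import Function using (_∘_; id)
open import Relation.Nullary using (¬_; Dec; yes; no; contradiction)
open import Relation.Nullary.Decidable using (_×-dec_; _⊎-dec_)
open import Relation.Binary using (tri<; tri≈; tri>)
open import Relation.Binary.PropositionalEquality
  using (_≢_; _≗_; refl; sym; trans; cong; cong₂; subst; module ≡-Reasoning)
open import Algebra.Properties.Semiring.Sum ℤP.+-*-semiring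
  using (sum; sum-syntax; sum-cong-≗; ∑-distrib-+; ∑-comm; *-distribˡ-sum;
         sum-remove; sum-replicate-zero)

open ≡-Reasoning

sumℤ-tabulate : ∀ {n} (f : Fin n → ℤ) → sumℤ (L.tabulate f) ≡ sum f
sumℤ-tabulate {zero}  f = refl
sumℤ-tabulate {suc n} f = cong (λ s → f zero + s) (sumℤ-tabulate (f ∘ suc))

sumℤ-allFin : ∀ {n} (f : Fin n → ℤ) → sumℤ (L.map f (allFin n)) ≡ sum f
sumℤ-allFin f = trans (cong sumℤ (map-tabulate id f)) (sumℤ-tabulate f)

sum-zero : ∀ {n} {f : Fin n → ℤ} → (∀ i → f i ≡ 0ℤ) → sum f ≡ 0ℤ
sum-zero {n} f≡0 = trans (sum-cong-≗ f≡0) (sum-replicate-zero n)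

sum-supported-at : ∀ {n} (f : Fin n → ℤ) i → (∀ j → j ≢ i → f j ≡ 0ℤ) → sum f ≡ f i
sum-supported-at {suc n} f i off = begin
  sum f                       ≡⟨ sum-remove {i = i} f ⟩
  f i + sum (f ∘ F.punchIn i) ≡⟨ cong (λ s → f i + s) (sum-zero (λ k → off _ (FP.punchInᵢ≢i i k))) ⟩
  f i + 0ℤ                    ≡⟨ ℤP.+-identityʳ (f i) ⟩
  f i                         ∎

sum-nonneg : ∀ {n} {f : Fin n → ℤ} → (∀ i → 0ℤ ≤ f i) → (∀ i → f i ≡ 0ℤ) ⊎ 0ℤ < sum f
sum-nonneg {zero}      f≥0 = inj₁ λ ()
sum-nonneg {suc n} {f} f≥0 with sum-nonneg (f≥0 ∘ suc) | f zero ℤP.≟ 0ℤ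
... | inj₂ rest>0 | _        = inj₂ (ℤP.+-mono-≤-< (f≥0 zero) rest>0)
... | inj₁ rest≡0 | yes f₀≡0 = inj₁ λ { zero → f₀≡0 ; (suc i) → rest≡0 i }
... | inj₁ rest≡0 | no f₀≢0  = inj₂ (subst (0ℤ <_) (sym sum≡f₀) (ℤP.≤∧≢⇒< (f≥0 zero) (f₀≢0 ∘ sym)))
  where
  sum≡f₀ : sum f ≡ f zero
  sum≡f₀ = trans (cong (λ s → f zero + s) (sum-zero rest≡0)) (ℤP.+-identityʳ (f zero))

module Energy {n : ℕ} (W : Matrix n) (W-sym : Symmetric W) where

  infix 7 _·_

  _·_ : (Fin n → ℤ) → (Fin n → ℤ) → ℤ
  u · v = ∑[ i < n ] (u i * v i)

  applyW : (Fin n → ℤ) → Fin n → ℤ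
  applyW u i = ∑[ j < n ] (W i j * u j)

  -- Twice the Hopfield energy bᵀu − ½ uᵀWu, doubled to stay in ℤ.
  energy : (b u : Fin n → ℤ) → ℤ
  energy b u = + 2 * (b · u) - u · applyW u

  ·-cong : ∀ {u u′ v v′} → u ≗ u′ → v ≗ v′ → u · v ≡ u′ · v′
  ·-cong {u} {u′} {v} {v′} u≗u′ v≗v′ = sum-cong-≗ (λ i → cong₂ _*_ (u≗u′ i) (v≗v′ i))

  applyW-cong : ∀ {u v} → u ≗ v → applyW u ≗ applyW v
  applyW-cong {u} {v} u≗v i = sum-cong-≗ (λ j → cong (W i j *_) (u≗v j))

  energy-cong : ∀ b {u v} → u ≗ v → energy b u ≡ energy b v
  energy-cong b {u} {v} u≗v =
    cong₂ (λ l q → + 2 * l - q) (·-cong {b} (λ _ → refl) u≗v)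
                                (·-cong u≗v (applyW-cong {u} u≗v))

  ·-distribʳ-+ : ∀ t u v → t · (λ i → u i + v i) ≡ t · u + t · v
  ·-distribʳ-+ t u v =
    trans (sum-cong-≗ (λ i → ℤP.*-distribˡ-+ (t i) (u i) (v i))) (∑-distrib-+ (λ i → t i * u i) _)

  ·-distribˡ-+ : ∀ t u v → (λ i → u i + v i) · t ≡ u · t + v · t
  ·-distribˡ-+ t u v =
    trans (sum-cong-≗ (λ i → ℤP.*-distribʳ-+ (t i) (u i) (v i))) (∑-distrib-+ (λ i → u i * t i) _)

  applyW-+ : ∀ u v → applyW (λ i → u i + v i) ≗ λ i → applyW u i + applyW v i
  applyW-+ u v i =
    trans (sum-cong-≗ (λ j → ℤP.*-distribˡ-+ (W i j) (u j) (v j))) (∑-distrib-+ (λ j → W i j * u j) _)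

  ·-applyW : ∀ u v → u · applyW v ≡ v · applyW u
  ·-applyW u v = begin
    ∑[ i < n ] (u i * ∑[ j < n ] (W i j * v j))
      ≡⟨ sum-cong-≗ (λ i → *-distribˡ-sum (u i) (λ j → W i j * v j)) ⟩
    ∑[ i < n ] ∑[ j < n ] (u i * (W i j * v j))
      ≡⟨ ∑-comm (λ i j → u i * (W i j * v j)) ⟩
    ∑[ j < n ] ∑[ i < n ] (u i * (W i j * v j))
      ≡⟨ sum-cong-≗ (λ j → sum-cong-≗ (λ i →
           trans (reorder (u i) (W i j) (v j)) (cong (λ p → v j * (p * u i)) (W-sym i j)))) ⟩
    ∑[ j < n ] ∑[ i < n ] (v j * (W j i * u i))
      ≡⟨ sum-cong-≗ (λ j → *-distribˡ-sum (v j) (λ i → W j i * u i)) ⟨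
    ∑[ j < n ] (v j * ∑[ i < n ] (W j i * u i))
      ∎
    where
    reorder : ∀ x p y → x * (p * y) ≡ y * (p * x)
    reorder = solve-∀

  quad-+ : ∀ u d → (λ i → u i + d i) · applyW (λ i → u i + d i)
                   ≡ u · applyW u + + 2 * (d · applyW u) + d · applyW d
  quad-+ u d = begin
    (λ i → u i + d i) · applyW (λ i → u i + d i)
      ≡⟨ ·-cong {λ i → u i + d i} (λ _ → refl) (applyW-+ u d) ⟩
    (λ i → u i + d i) · (λ i → applyW u i + applyW d i)
      ≡⟨ ·-distribˡ-+ (λ i → applyW u i + applyW d i) u d ⟩
    u · (λ i → applyW u i + applyW d i) + d · (λ i → applyW u i + applyW d i)
      ≡⟨ cong₂ _+_ (·-distribʳ-+ u (applyW u) (applyW d)) (·-distribʳ-+ d (applyW u) (applyW d)) ⟩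
    (u · applyW u + u · applyW d) + (d · applyW u + d · applyW d)
      ≡⟨ cong (λ x → (u · applyW u + x) + (d · applyW u + d · applyW d)) (·-applyW u d) ⟩
    (u · applyW u + d · applyW u) + (d · applyW u + d · applyW d)
      ≡⟨ collect (u · applyW u) (d · applyW u) (d · applyW d) ⟩
    u · applyW u + + 2 * (d · applyW u) + d · applyW d
      ∎
    where
    collect : ∀ q m r → (q + m) + (m + r) ≡ q + + 2 * m + r
    collect = solve-∀

  energy-+ : ∀ b u d → energy b u ≡ energy b (λ i → u i + d i)
                                     + d · (λ i → + 2 * (applyW u i - b i) + applyW d i)
  energy-+ b u d = begin
    + 2 * (b · u) - u · applyW u
      ≡⟨ regroup (b · u) (b · d) (u · applyW u) (d · applyW u) (d · applyW d) ⟩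
    (+ 2 * (b · u + b · d) - (u · applyW u + + 2 * (d · applyW u) + d · applyW d))
      + ((+ 2 * (d · applyW u) + - + 2 * (b · d)) + d · applyW d)
      ≡⟨ cong₂ (λ l q → (+ 2 * l - q) + ((+ 2 * (d · applyW u) + - + 2 * (b · d)) + d · applyW d))
               (·-distribʳ-+ b u d) (quad-+ u d) ⟨
    energy b (λ i → u i + d i) + ((+ 2 * (d · applyW u) + - + 2 * (b · d)) + d · applyW d)
      ≡⟨ cong (λ g → energy b (λ i → u i + d i) + g) gain ⟨
    energy b (λ i → u i + d i) + d · (λ i → + 2 * (applyW u i - b i) + applyW d i)
      ∎
    where
    regroup : ∀ bu bd q m r →
      + 2 * bu - q ≡ (+ 2 * (bu + bd) - (q + + 2 * m + r)) + ((+ 2 * m + - + 2 * bd) + r)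
    regroup = solve-∀
    expand : ∀ di ai bi ri →
      di * (+ 2 * (ai - bi) + ri) ≡ (+ 2 * (di * ai) + - + 2 * (bi * di)) + di * ri
    expand = solve-∀
    gain : d · (λ i → + 2 * (applyW u i - b i) + applyW d i)
           ≡ (+ 2 * (d · applyW u) + - + 2 * (b · d)) + d · applyW d
    gain = begin
      ∑[ i < n ] (d i * (+ 2 * (applyW u i - b i) + applyW d i))
        ≡⟨ sum-cong-≗ (λ i → expand (d i) (applyW u i) (b i) (applyW d i)) ⟩
      ∑[ i < n ] ((+ 2 * (d i * applyW u i) + - + 2 * (b i * d i)) + d i * applyW d i)
        ≡⟨ ∑-distrib-+ (λ i → + 2 * (d i * applyW u i) + - + 2 * (b i * d i)) (λ i → d i * applyW d i) ⟩
      ∑[ i < n ] (+ 2 * (d i * applyW u i) + - + 2 * (b i * d i)) + d · applyW d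
        ≡⟨ cong (_+ d · applyW d) (∑-distrib-+ (λ i → + 2 * (d i * applyW u i)) (λ i → - + 2 * (b i * d i))) ⟩
      (∑[ i < n ] (+ 2 * (d i * applyW u i)) + ∑[ i < n ] (- + 2 * (b i * d i))) + d · applyW d
        ≡⟨ cong (_+ d · applyW d) (cong₂ _+_ (*-distribˡ-sum (+ 2) (λ i → d i * applyW u i))
                                              (*-distribˡ-sum (- + 2) (λ i → b i * d i))) ⟨
      (+ 2 * (d · applyW u) + - + 2 * (b · d)) + d · applyW d
        ∎

threshold : ℤ → Sign → Sign
threshold +0       s = s
threshold +[1+ _ ] s = plus
threshold -[1+ _ ] s = minus

threshold-pos : ∀ {h} s → 0ℤ < h → threshold h s ≡ plus
threshold-pos {+[1+ _ ]} s _ = refl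
threshold-pos {+0}       s (+<+ ())

threshold-zero : ∀ {h} s → h ≡ 0ℤ → threshold h s ≡ s
threshold-zero s refl = refl

threshold-neg : ∀ {h} s → ¬ 0ℤ < h → h ≢ 0ℤ → threshold h s ≡ minus
threshold-neg {+0}       s _   h≢0 = contradiction refl h≢0
threshold-neg {+[1+ _ ]} s h≯0 _   = contradiction (+<+ (s≤s z≤n)) h≯0
threshold-neg { -[1+ _ ]} s _   _   = refl

localF≡threshold : ∀ {n} (G : SignedGraph n) b i x →
  localF G b i x ≡ threshold (localField G b i x) (lookup x i)
localF≡threshold G b i x with 0ℤ ℤ.<? localField G b i x | localField G b i x ℤP.≟ 0ℤ
... | yes h>0 | _       = sym (threshold-pos (lookup x i) h>0)
... | no  h≯0 | yes h≡0 = sym (threshold-zero (lookup x i) h≡0)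
... | no  h≯0 | no  h≢0 = sym (threshold-neg (lookup x i) h≯0 h≢0)

-- The loop weight ℓ = -1 is excluded for good reason: with h = 1 the spin flips from minus
-- to plus while the gain is 0, so the energy would not detect the move.
threshold-gain : ∀ h s ℓ → ℓ ≡ 0ℤ ⊎ ℓ ≡ 1ℤ →
  let δ = spin (threshold h s) - spin s in
  0ℤ ≤ δ * (+ 2 * h + ℓ * δ) × (δ * (+ 2 * h + ℓ * δ) ≡ 0ℤ → threshold h s ≡ s)
threshold-gain +0       plus  _ _          = +≤+ z≤n , λ _ → refl
threshold-gain +0       minus _ _          = +≤+ z≤n , λ _ → refl
threshold-gain +[1+ _ ] plus  _ _          = +≤+ z≤n , λ _ → refl
threshold-gain +[1+ _ ] minus _ (inj₁ refl) = +≤+ z≤n , λ ()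
threshold-gain +[1+ _ ] minus _ (inj₂ refl) = +≤+ z≤n , λ ()
threshold-gain -[1+ _ ] plus  _ (inj₁ refl) = +≤+ z≤n , λ ()
threshold-gain -[1+ _ ] plus  _ (inj₂ refl) = +≤+ z≤n , λ ()
threshold-gain -[1+ _ ] minus _ _          = +≤+ z≤n , λ _ → refl

IsStrictLyapunov : ∀ {A : Set} → (A → ℤ) → (A → A) → Set
IsStrictLyapunov E F = ∀ x → F x ≡ x ⊎ E (F x) < E x

module _ {A : Set} {E : A → ℤ} where

  IsStrictLyapunov-∘ : ∀ {f g : A → A} → IsStrictLyapunov E f → IsStrictLyapunov E g →
                       IsStrictLyapunov E (g ∘ f)
  IsStrictLyapunov-∘ {f} {g} f↓ g↓ x with f↓ x
  ... | inj₁ fx≡x rewrite fx≡x = g↓ x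
  ... | inj₂ fx<x with g↓ (f x)
  ...   | inj₁ gfx≡fx = inj₂ (subst (λ y → E y < E x) (sym gfx≡fx) fx<x)
  ...   | inj₂ gfx<fx = inj₂ (ℤP.<-trans gfx<fx fx<x)

  IsStrictLyapunov⇒≤ : ∀ {F} → IsStrictLyapunov E F → ∀ x → E (F x) ≤ E x
  IsStrictLyapunov⇒≤ F↓ x with F↓ x
  ... | inj₁ Fx≡x = ℤP.≤-reflexive (cong E Fx≡x)
  ... | inj₂ Fx<x = ℤP.<⇒≤ Fx<x

  IsStrictLyapunov-iter : ∀ {F} → IsStrictLyapunov E F → ∀ k x → E (iter F (suc k) x) ≤ E (F x)
  IsStrictLyapunov-iter F↓ zero    x = ℤP.≤-refl
  IsStrictLyapunov-iter {F} F↓ (suc k) x =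
    ℤP.≤-trans (IsStrictLyapunov⇒≤ F↓ (iter F (suc k) x)) (IsStrictLyapunov-iter F↓ k x)

  IsStrictLyapunov⇒period≡1 : ∀ {F x p} → IsStrictLyapunov E F → IsAttractorOfPeriod F x p → p ≡ 1
  IsStrictLyapunov⇒period≡1 {F} {x} {suc zero}    F↓ _                 = refl
  IsStrictLyapunov⇒period≡1 {F} {x} {suc (suc k)} F↓ (_ , cycle , minimal) with F↓ x
  ... | inj₁ Fx≡x = contradiction Fx≡x (minimal 1 (s≤s z≤n) (s≤s (s≤s z≤n)))
  ... | inj₂ Fx<x = contradiction
        (ℤP.<-≤-trans Fx<x (subst (λ y → E y ≤ E (F x)) cycle (IsStrictLyapunov-iter F↓ (suc k) x)))
        (ℤP.<-irrefl refl)

Independent : ∀ {n} → SignedGraph n → Subset n → Set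
Independent G I = ∀ {i j} → i ∈ₛ I → j ∈ₛ I → i ≢ j → w G i j ≡ 0ℤ

NoNegativeLoop : ∀ {n} → SignedGraph n → Subset n → Set
NoNegativeLoop G I = ∀ {i} → i ∈ₛ I → w G i i ≢ -1ℤ

NoNegativeLoop⇒loop≡0⊎1 : ∀ {n} (G : SignedGraph n) {I i} → NoNegativeLoop G I → i ∈ₛ I →
                          w G i i ≡ 0ℤ ⊎ w G i i ≡ 1ℤ
NoNegativeLoop⇒loop≡0⊎1 G {i = i} noNegativeLoop i∈I with w-val G i i
... | inj₁ wᵢᵢ≡0         = inj₁ wᵢᵢ≡0
... | inj₂ (inj₁ wᵢᵢ≡1)  = inj₂ wᵢᵢ≡1
... | inj₂ (inj₂ wᵢᵢ≡-1) = contradiction wᵢᵢ≡-1 (noNegativeLoop i∈I)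

≤-sumℕ-map : ∀ {A : Set} (f : A → ℕ) {x xs} → x ∈ xs → f x ℕ.≤ sumℕ (L.map f xs)
≤-sumℕ-map f {xs = y L.∷ _} (here refl)  = ℕP.m≤m+n (f y) _
≤-sumℕ-map f {xs = y L.∷ _} (there x∈ys) = ℕP.≤-trans (≤-sumℕ-map f x∈ys) (ℕP.m≤n+m _ (f y))

edgeCount-pos-< : ∀ {n} (a : Matrix n) {i j} → i F.< j → a i j ≢ 0ℤ → 1 ℕ.≤ edgeCount a
edgeCount-pos-< a {i} {j} i<j aᵢⱼ≢0 =
  ℕP.≤-trans (filter-some _ (Any-tabulate⁺ j (i<j , aᵢⱼ≢0))) (≤-sumℕ-map _ (∈-allFin i))

edgeCount-pos : ∀ {n} (a : Matrix n) → Symmetric a → ∀ {i j} → i ≢ j → a i j ≢ 0ℤ →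
                1 ℕ.≤ edgeCount a
edgeCount-pos a a-sym {i} {j} i≢j aᵢⱼ≢0 with FP.<-cmp i j
... | tri< i<j _ _ = edgeCount-pos-< a i<j aᵢⱼ≢0
... | tri≈ _ i≡j _ = contradiction i≡j i≢j
... | tri> _ _ j<i = edgeCount-pos-< a j<i (aᵢⱼ≢0 ∘ trans (a-sym i j))

negLoops-pos : ∀ {n} (a : Matrix n) {i} → a i i ≡ -1ℤ → 1 ℕ.≤ negLoops a
negLoops-pos a {i} aᵢᵢ≡-1 = filter-some _ (Any-tabulate⁺ i aᵢᵢ≡-1)

∣p∪q∣≤∣p∣+∣q∣ : ∀ {n} (p q : Subset n) → ∣ p ∪ q ∣ ℕ.≤ ∣ p ∣ ℕ.+ ∣ q ∣
∣p∪q∣≤∣p∣+∣q∣ []          []          = z≤n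
∣p∪q∣≤∣p∣+∣q∣ (true ∷ p)  (true ∷ q)  =
  s≤s (ℕP.≤-trans (∣p∪q∣≤∣p∣+∣q∣ p q) (ℕP.+-monoʳ-≤ ∣ p ∣ (ℕP.n≤1+n ∣ q ∣)))
∣p∪q∣≤∣p∣+∣q∣ (true ∷ p)  (false ∷ q) = s≤s (∣p∪q∣≤∣p∣+∣q∣ p q)
∣p∪q∣≤∣p∣+∣q∣ (false ∷ p) (true ∷ q)  =
  ℕP.≤-trans (s≤s (∣p∪q∣≤∣p∣+∣q∣ p q)) (ℕP.≤-reflexive (sym (ℕP.+-suc ∣ p ∣ ∣ q ∣)))
∣p∪q∣≤∣p∣+∣q∣ (false ∷ p) (false ∷ q) = ∣p∪q∣≤∣p∣+∣q∣ p q

acyclic⇒IsRho0 : ∀ {n} (a : Matrix n) → Symmetric a → (∀ vs → ¬ IsCycle a vs) → IsRho a 0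
acyclic⇒IsRho0 a a-sym acyclic =
  ( a , (a-sym , (λ _ → refl) , (λ _ _ _ → inj₂ refl))
      , (λ vs cycle → contradiction cycle (acyclic vs))
      , sym (ℕP.n∸n≡0 (edgeCount a)) )
  , λ _ _ _ → z≤n

𝒮-nonneg : ∀ {n} {G : SignedGraph n} {I} (H : Subgraph G I) → posLoops (w' H) ≡ 0 →
           ∣ U H ∣ ℕ.≤ negLoops (w' H) ℕ.+ 2 ℕ.* edgeCount (w' H) → 0ℤ ≤ 𝒮 H 0
𝒮-nonneg H d⁺≡0 bound rewrite d⁺≡0 =
  subst (0ℤ ≤_) (sym (trans (regroup (+ ∣ U H ∣) (+ d⁻) (+ (2 ℕ.* m)))
                            (cong (_- + ∣ U H ∣) (sym (ℤP.pos-+ d⁻ (2 ℕ.* m))))))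
        (ℤP.i≤j⇒0≤j-i (+≤+ bound))
  where
  d⁻ m : ℕ
  d⁻ = negLoops (w' H)
  m  = edgeCount (w' H)
  regroup : ∀ u d⁻ m → - u - 0ℤ + d⁻ + m - 0ℤ ≡ (d⁻ + m) - u
  regroup = solve-∀

-- The subgraph consisting of the edge (or loop, when a ≡ c) between a and c alone.
module PairSubgraph {n : ℕ} (G : SignedGraph n) (a c : Fin n) where

  OnPair : Fin n → Fin n → Set
  OnPair k l = (k ≡ a × l ≡ c) ⊎ (k ≡ c × l ≡ a)

  onPair? : ∀ k l → Dec (OnPair k l)
  onPair? k l = (k F.≟ a ×-dec l F.≟ c) ⊎-dec (k F.≟ c ×-dec l F.≟ a)

  OnPair-sym : ∀ {k l} → OnPair k l → OnPair l k
  OnPair-sym (inj₁ (k≡a , l≡c)) = inj₂ (l≡c , k≡a)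
  OnPair-sym (inj₂ (k≡c , l≡a)) = inj₁ (l≡a , k≡c)

  OnPair-diag : ∀ {k} → OnPair k k → k ≡ a × a ≡ c
  OnPair-diag (inj₁ (k≡a , k≡c)) = k≡a , trans (sym k≡a) k≡c
  OnPair-diag (inj₂ (k≡c , k≡a)) = k≡a , trans (sym k≡a) k≡c

  pairVertices : Subset n
  pairVertices = ⁅ a ⁆ ∪ ⁅ c ⁆

  OnPair⇒∈ : ∀ {k l} → OnPair k l → k ∈ₛ pairVertices × l ∈ₛ pairVertices
  OnPair⇒∈ (inj₁ (refl , refl)) = x∈p∪q⁺ (inj₁ (x∈⁅x⁆ a)) , x∈p∪q⁺ (inj₂ (x∈⁅x⁆ c))
  OnPair⇒∈ (inj₂ (refl , refl)) = x∈p∪q⁺ (inj₂ (x∈⁅x⁆ c)) , x∈p∪q⁺ (inj₁ (x∈⁅x⁆ a))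

  pairMatrix : Matrix n
  pairMatrix k l with onPair? k l
  ... | yes _ = w G k l
  ... | no _  = 0ℤ

  pairMatrix-on : ∀ {k l} → OnPair k l → pairMatrix k l ≡ w G k l
  pairMatrix-on {k} {l} onPair with onPair? k l
  ... | yes _       = refl
  ... | no ¬onPair  = contradiction onPair ¬onPair

  pairMatrix-support : ∀ {k l} → pairMatrix k l ≢ 0ℤ → OnPair k l
  pairMatrix-support {k} {l} m≢0 with onPair? k l
  ... | yes onPair = onPair
  ... | no _       = contradiction refl m≢0

  pairMatrix-sym : Symmetric pairMatrix
  pairMatrix-sym k l with onPair? k l | onPair? l k
  ... | yes _  | yes _  = w-sym G k l
  ... | yes kl | no ¬lk = contradiction (OnPair-sym kl) ¬lk
  ... | no ¬kl | yes lk = contradiction (OnPair-sym lk) ¬kl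
  ... | no _   | no _   = refl

  -- Two consecutive edges of a cycle would both lie on the pair {a, c}, forcing a repeated vertex.
  pairMatrix-acyclic : ∀ vs → ¬ IsCycle pairMatrix vs
  pairMatrix-acyclic (v₀ L.∷ v₁ L.∷ v₂ L.∷ _)
                     (_ , (v₀≢v₁ ∷ v₀≢v₂ ∷ _) ∷ _ , e₀₁ ∷ e₁₂ ∷ _) =
    repeated (pairMatrix-support e₀₁) (pairMatrix-support e₁₂)
    where
    repeated : OnPair v₀ v₁ → OnPair v₁ v₂ → ⊥
    repeated (inj₁ (v₀≡a , _)) (inj₁ (v₁≡a , _)) = v₀≢v₁ (trans v₀≡a (sym v₁≡a))
    repeated (inj₁ (v₀≡a , _)) (inj₂ (_ , v₂≡a)) = v₀≢v₂ (trans v₀≡a (sym v₂≡a))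
    repeated (inj₂ (v₀≡c , _)) (inj₁ (_ , v₂≡c)) = v₀≢v₂ (trans v₀≡c (sym v₂≡c))
    repeated (inj₂ (v₀≡c , _)) (inj₂ (v₁≡c , _)) = v₀≢v₁ (trans v₀≡c (sym v₁≡c))
  pairMatrix-acyclic L.[]                    (() , _)
  pairMatrix-acyclic (_ L.∷ L.[])            (s≤s () , _)
  pairMatrix-acyclic (_ L.∷ _ L.∷ L.[])      (s≤s (s≤s ()) , _)

  pairMatrix-posLoops : (a ≡ c → w G a a ≢ 1ℤ) → posLoops pairMatrix ≡ 0
  pairMatrix-posLoops no-positive-loop = cong length (filter-none _ (All-tabulate⁺ not-positive))
    where
    not-positive : ∀ k → pairMatrix k k ≢ 1ℤ
    not-positive k mₖₖ≡1 with OnPair-diag (pairMatrix-support {k} nonzero)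
      where
      nonzero : pairMatrix k k ≢ 0ℤ
      nonzero mₖₖ≡0 with trans (sym mₖₖ≡1) mₖₖ≡0
      ... | ()
    ... | refl , a≡c = no-positive-loop a≡c (trans (sym (pairMatrix-on (inj₁ (refl , a≡c)))) mₖₖ≡1)

  pairSubgraph : ∀ {I} → a ∈ₛ I → c ∈ₛ I → Subgraph G I
  pairSubgraph {I} a∈I c∈I = record
    { U      = pairVertices
    ; U⊆I    = pairVertices⊆I
    ; U≠∅    = a , x∈p∪q⁺ (inj₁ (x∈⁅x⁆ a))
    ; w'     = pairMatrix
    ; w'-sym = pairMatrix-sym
    ; w'-sub = restriction
    }
    where
    pairVertices⊆I : pairVertices ⊆ I
    pairVertices⊆I k∈ with x∈p∪q⁻ ⁅ a ⁆ ⁅ c ⁆ k∈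
    ... | inj₁ k∈⁅a⁆ = subst (_∈ₛ I) (sym (x∈⁅y⁆⇒x≡y a k∈⁅a⁆)) a∈I
    ... | inj₂ k∈⁅c⁆ = subst (_∈ₛ I) (sym (x∈⁅y⁆⇒x≡y c k∈⁅c⁆)) c∈I

    restriction : ∀ k l → pairMatrix k l ≡ 0ℤ
                          ⊎ (k ∈ₛ pairVertices × l ∈ₛ pairVertices × pairMatrix k l ≡ w G k l)
    restriction k l with onPair? k l
    ... | yes onPair = inj₂ (proj₁ (OnPair⇒∈ onPair) , proj₂ (OnPair⇒∈ onPair) , refl)
    ... | no _       = inj₁ refl

𝒮Negative : ∀ {n} → SignedGraph n → Subset n → Set
𝒮Negative G I = ∀ (H : Subgraph G I) (r : ℕ) → IsRho (w' H) r → 𝒮 H r < 0ℤ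

module _ {n} {G : SignedGraph n} {I : Subset n} (negative : 𝒮Negative G I) where

  -- The pair subgraph is acyclic, so ρ = 0 and 𝒮 = d⁻ + 2m − |U| (when d⁺ = 0).
  pair-¬𝒮≥0 : ∀ {a c} → a ∈ₛ I → c ∈ₛ I → (a ≡ c → w G a a ≢ 1ℤ) →
    let open PairSubgraph G a c in
    ¬ (∣ pairVertices ∣ ℕ.≤ negLoops pairMatrix ℕ.+ 2 ℕ.* edgeCount pairMatrix)
  pair-¬𝒮≥0 {a} {c} a∈I c∈I no-positive-loop bound =
    ℤP.<-irrefl refl (ℤP.≤-<-trans (𝒮-nonneg H (pairMatrix-posLoops no-positive-loop) bound)
                                   (negative H 0 ρ≡0))
    where
    open PairSubgraph G a c
    H : Subgraph G I
    H = pairSubgraph a∈I c∈I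
    ρ≡0 : IsRho pairMatrix 0
    ρ≡0 = acyclic⇒IsRho0 pairMatrix pairMatrix-sym pairMatrix-acyclic

  𝒮Negative⇒NoNegativeLoop : NoNegativeLoop G I
  𝒮Negative⇒NoNegativeLoop {i} i∈I wᵢᵢ≡-1 =
    pair-¬𝒮≥0 i∈I i∈I (λ _ wᵢᵢ≡1 → contradiction (trans (sym wᵢᵢ≡-1) wᵢᵢ≡1) λ ()) bound
    where
    open PairSubgraph G i i
    bound : ∣ ⁅ i ⁆ ∪ ⁅ i ⁆ ∣ ℕ.≤ negLoops pairMatrix ℕ.+ 2 ℕ.* edgeCount pairMatrix
    bound = ℕP.≤-trans (ℕP.≤-reflexive (trans (cong ∣_∣ (∪-idem ⁅ i ⁆)) (∣⁅x⁆∣≡1 i)))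
              (ℕP.≤-trans (negLoops-pos pairMatrix {i} (trans (pairMatrix-on (inj₁ (refl , refl))) wᵢᵢ≡-1))
                          (ℕP.m≤m+n (negLoops pairMatrix) _))

  𝒮Negative⇒Independent : Independent G I
  𝒮Negative⇒Independent {i} {j} i∈I j∈I i≢j with w G i j ℤP.≟ 0ℤ
  ... | yes wᵢⱼ≡0 = wᵢⱼ≡0
  ... | no  wᵢⱼ≢0 = contradiction bound (pair-¬𝒮≥0 i∈I j∈I (λ i≡j → contradiction i≡j i≢j))
    where
    open PairSubgraph G i j
    one-edge : 1 ℕ.≤ edgeCount pairMatrix
    one-edge = edgeCount-pos pairMatrix pairMatrix-sym i≢j
                 (wᵢⱼ≢0 ∘ trans (sym (pairMatrix-on (inj₁ (refl , refl)))))
    bound : ∣ ⁅ i ⁆ ∪ ⁅ j ⁆ ∣ ℕ.≤ negLoops pairMatrix ℕ.+ 2 ℕ.* edgeCount pairMatrix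
    bound = ℕP.≤-trans (∣p∪q∣≤∣p∣+∣q∣ ⁅ i ⁆ ⁅ j ⁆)
              (ℕP.≤-trans (ℕP.≤-reflexive (cong₂ ℕ._+_ (∣⁅x⁆∣≡1 i) (∣⁅x⁆∣≡1 j)))
                (ℕP.≤-trans (ℕP.*-monoʳ-≤ 2 one-edge) (ℕP.m≤n+m _ (negLoops pairMatrix))))

module BlockUpdate {n : ℕ} (G : SignedGraph n) (b : Fin n → ℤ) where

  open Energy (w G) (w-sym G)

  spins : Config n → Fin n → ℤ
  spins x i = spin (lookup x i)

  networkEnergy : Config n → ℤ
  networkEnergy x = energy b (spins x)

  fI-inside : ∀ {I} x {i} → lookup I i ≡ true →
              lookup (fI G b I x) i ≡ threshold (applyW (spins x) i - b i) (lookup x i)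
  fI-inside {I} x {i} i∈I = begin
    lookup (fI G b I x) i
      ≡⟨ lookup∘tabulate _ i ⟩
    (if lookup I i then localF G b i x else lookup x i)
      ≡⟨ cong (if_then localF G b i x else lookup x i) i∈I ⟩
    localF G b i x
      ≡⟨ localF≡threshold G b i x ⟩
    threshold (localField G b i x) (lookup x i)
      ≡⟨ cong (λ h → threshold (h - b i) (lookup x i)) (sumℤ-allFin (λ j → w G i j * spins x j)) ⟩
    threshold (applyW (spins x) i - b i) (lookup x i)
      ∎

  fI-outside : ∀ {I} x {i} → lookup I i ≡ false → lookup (fI G b I x) i ≡ lookup x i
  fI-outside {I} x {i} i∉I =
    trans (lookup∘tabulate _ i) (cong (if_then localF G b i x else lookup x i) i∉I)

  module BlockStep {I : Subset n} (independent : Independent G I)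
                   (noNegativeLoop : NoNegativeLoop G I) (x : Config n) where

    y : Config n
    y = fI G b I x

    u : Fin n → ℤ
    u = spins x

    d : Fin n → ℤ
    d i = spins y i - u i

    h : Fin n → ℤ
    h i = applyW u i - b i

    gain : Fin n → ℤ
    gain i = d i * (+ 2 * h i + applyW d i)

    energy-drop : networkEnergy x ≡ networkEnergy y + ∑[ i < n ] gain i
    energy-drop = trans (energy-+ b u d)
      (cong (_+ ∑[ i < n ] gain i) (energy-cong b (λ i → cancel (u i) (spins y i))))
      where
      cancel : ∀ p q → p + (q - p) ≡ q
      cancel = solve-∀

    unchanged⇒d≡0 : ∀ {i} → lookup y i ≡ lookup x i → d i ≡ 0ℤ
    unchanged⇒d≡0 yᵢ≡xᵢ = ℤP.i≡j⇒i-j≡0 (cong spin yᵢ≡xᵢ)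

    -- Only the loop at i survives in (W d) i: other vertices of I are not adjacent to i,
    -- and vertices outside I do not move.
    applyW-d : ∀ {i} → lookup I i ≡ true → applyW d i ≡ w G i i * d i
    applyW-d {i} i∈I = sum-supported-at (λ j → w G i j * d j) i off-diagonal
      where
      off-diagonal : ∀ j → j ≢ i → w G i j * d j ≡ 0ℤ
      off-diagonal j j≢i with lookup I j in j∈?I
      ... | true  = cong (_* d j)
                      (independent (lookup⇒[]= i I i∈I) (lookup⇒[]= j I j∈?I) (j≢i ∘ sym))
      ... | false = trans (cong (w G i j *_) (unchanged⇒d≡0 (fI-outside {I} x j∈?I)))
                          (ℤP.*-zeroʳ (w G i j))

    vertex-gain : ∀ i → 0ℤ ≤ gain i × (gain i ≡ 0ℤ → lookup y i ≡ lookup x i)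
    vertex-gain i with lookup I i in i∈?I
    ... | false = ℤP.≤-reflexive (sym gain≡0) , λ _ → yᵢ≡xᵢ
      where
      yᵢ≡xᵢ : lookup y i ≡ lookup x i
      yᵢ≡xᵢ = fI-outside {I} x i∈?I
      gain≡0 : gain i ≡ 0ℤ
      gain≡0 = cong (λ δ → δ * (+ 2 * h i + applyW d i)) (unchanged⇒d≡0 yᵢ≡xᵢ)
    ... | true with threshold-gain (h i) (lookup x i) (w G i i)
                      (NoNegativeLoop⇒loop≡0⊎1 G noNegativeLoop (lookup⇒[]= i I i∈?I))
    ... | gain≥0 , gain≡0⇒fixed = subst (0ℤ ≤_) (sym gain≡) gain≥0 ,
                                  λ g≡0 → trans yᵢ (gain≡0⇒fixed (trans (sym gain≡) g≡0))
      where
      yᵢ : lookup y i ≡ threshold (h i) (lookup x i)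
      yᵢ = fI-inside {I} x i∈?I
      δ : ℤ
      δ = spin (threshold (h i) (lookup x i)) - u i
      gain≡ : gain i ≡ δ * (+ 2 * h i + w G i i * δ)
      gain≡ = trans (cong (λ a → d i * (+ 2 * h i + a)) (applyW-d i∈?I))
                    (cong (λ δ → δ * (+ 2 * h i + w G i i * δ)) (cong (λ s → spin s - u i) yᵢ))

    fixed : (∀ i → gain i ≡ 0ℤ) → y ≡ x
    fixed no-gain = trans (tabulate-cong unchanged) (tabulate∘lookup x)
      where
      unchanged : ∀ i → _ ≡ lookup x i
      unchanged i = trans (sym (lookup∘tabulate _ i)) (proj₂ (vertex-gain i) (no-gain i))

    decreased : 0ℤ < ∑[ i < n ] gain i → networkEnergy y < networkEnergy x
    decreased gain>0 = subst (networkEnergy y <_) (sym energy-drop)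
      (subst (_< networkEnergy y + ∑[ i < n ] gain i) (ℤP.+-identityʳ (networkEnergy y))
        (ℤP.+-monoʳ-< (networkEnergy y) gain>0))

  fI-descends : ∀ {I} → Independent G I → NoNegativeLoop G I →
                IsStrictLyapunov networkEnergy (fI G b I)
  fI-descends independent noNegativeLoop x =
    Sum.map fixed decreased (sum-nonneg (proj₁ ∘ vertex-gain))
    where open BlockStep independent noNegativeLoop x

  Fμ-descends : ∀ μ → (∀ I → I ∈ μ → Independent G I × NoNegativeLoop G I) →
                IsStrictLyapunov networkEnergy (Fμ G b μ)
  Fμ-descends L.[]      _    x = inj₁ refl
  Fμ-descends (I L.∷ μ) good =
    IsStrictLyapunov-∘ (fI-descends (proj₁ (good I (here refl))) (proj₂ (good I (here refl))))
                       (Fμ-descends μ (λ J → good J ∘ there))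

theorem5 : ∀ {n : ℕ} (G : SignedGraph n) (b : Fin n → ℤ) (μ : List (Subset n)) →
    (∀ I → I ∈ μ → ∀ (H : Subgraph G I) (r : ℕ) → IsRho (w' H) r → 𝒮 H r < 0ℤ) →
    ∀ (x : Config n) (p : ℕ) → IsAttractorOfPeriod (Fμ G b μ) x p → p ≡ 1
theorem5 G b μ negative _ _ attractor =
  IsStrictLyapunov⇒period≡1 (Fμ-descends μ stable-blocks) attractor
  where
  open BlockUpdate G b
  stable-blocks : ∀ I → I ∈ μ → Independent G I × NoNegativeLoop G I
  stable-blocks I I∈μ =
    𝒮Negative⇒Independent (negative I I∈μ) , 𝒮Negative⇒NoNegativeLoop (negative I I∈μ)
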